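{- In $\Lambda_\oplus$: (1) if $t\to_{\neg\mathsf h\beta}p$ and $p\mapsto_\oplus q$, then there is $r$ with $t\mapsto_\oplus r$ and $r\to_\beta^= q$; (2) if $t\to_{\neg\mathsf h\oplus}p$ and $p\mapsto_\oplus q$, then there is $r$ with $t\mapsto_\oplus r$ and $r\to_\oplus^= q$.
   Context: Terms of $\Lambda_\oplus$: $t::=x\mid\oplus\mid\lambda x.t\mid tt$, $\oplus$ a constant, modulo $\alpha$-equivalence. Contexts $C::=\langle\cdot\rangle\mid tC\mid Ct\mid\lambda x.C$; contextual closure $\to_\rho$ of $\mapsto_\rho$: $C\langle r\rangle\to_\rho C\langle r'\rangle$ for $r\mapsto_\rho r'$. Rules: $(\lambda x.p)q\mapsto_\beta p\{x:=q\}$; $\oplus tp\mapsto_\oplus t$ and $\oplus tp\mapsto_\oplus p$. Head contexts $H::=\lambda x_1\dots\lambda x_k.\langle\cdot\rangle t_1\dots t_n$ ($k,n\ge0$); $\to_{\neg\mathsf h\rho}$ is the closure of $\mapsto_\rho$ under contexts that are not head contexts. $\to^=$ is reflexive closure. -}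

module Defs where

-- Λ⊕ with well-scoped de Bruijn indices (terms modulo α-equivalence).
open import Data.Nat using (ℕ; zero; suc)
open import Data.Fin using (Fin; zero; suc)
open import Data.Product using (Σ; _×_; _,_)
open import Data.Sum using (_⊎_)
open import Relation.Nullary using (¬_)
open import Relation.Binary.PropositionalEquality using (_≡_)

data Term (n : ℕ) : Set where
  var : Fin n → Term n
  ⊕   : Term n
  lam : Term (suc n) → Term n
  app : Term n → Term n → Term n

ext : ∀ {n m} → (Fin n → Fin m) → Fin (suc n) → Fin (suc m)
ext ρ zero    = zero
ext ρ (suc i) = suc (ρ i)

rename : ∀ {n m} → (Fin n → Fin m) → Term n → Term m
rename ρ (var i)   = var (ρ i)
rename ρ ⊕         = ⊕
rename ρ (lam t)   = lam (rename (ext ρ) t)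
rename ρ (app t u) = app (rename ρ t) (rename ρ u)

exts : ∀ {n m} → (Fin n → Term m) → Fin (suc n) → Term (suc m)
exts σ zero    = var zero
exts σ (suc i) = rename suc (σ i)

subst : ∀ {n m} → (Fin n → Term m) → Term n → Term m
subst σ (var i)   = σ i
subst σ ⊕         = ⊕
subst σ (lam t)   = lam (subst (exts σ) t)
subst σ (app t u) = app (subst σ t) (subst σ u)

-- single substitution p{x:=q}, x being the bound variable 0
sub0 : ∀ {n} → Term n → Fin (suc n) → Term n
sub0 q zero    = q
sub0 q (suc i) = var i

_[_] : ∀ {n} → Term (suc n) → Term n → Term n
p [ q ] = subst (sub0 q) p

data Rule : Set where
  β ⊕r : Rule

data Root : Rule → ∀ {n} → Term n → Term n → Set where
  beta : ∀ {n} (p : Term (suc n)) (q : Term n) → Root β (app (lam p) q) (p [ q ])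
  oplusL : ∀ {n} (t p : Term n) → Root ⊕r (app (app ⊕ t) p) t
  oplusR : ∀ {n} (t p : Term n) → Root ⊕r (app (app ⊕ t) p) p

-- Contexts: Ctx n m has outer scope n and hole scope m
data Ctx (n : ℕ) : ℕ → Set where
  hole : Ctx n n
  appR : ∀ {m} → Term n → Ctx n m → Ctx n m
  appL : ∀ {m} → Ctx n m → Term n → Ctx n m
  lamC : ∀ {m} → Ctx (suc n) m → Ctx n m

plug : ∀ {n m} → Ctx n m → Term m → Term n
plug hole       r = r
plug (appR t C) r = app t (plug C r)
plug (appL C t) r = app (plug C r) t
plug (lamC C)   r = lam (plug C r)

-- Head contexts λx1…λxk.⟨·⟩ t1 … tn
data IsSpine {n : ℕ} : ∀ {m} → Ctx n m → Set where
  hole : IsSpine hole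
  appL : ∀ {m} {C : Ctx n m} (t : Term n) → IsSpine C → IsSpine (appL C t)

data IsHead : ∀ {n m} → Ctx n m → Set where
  spine : ∀ {n m} {C : Ctx n m} → IsSpine C → IsHead C
  lamC  : ∀ {n m} {C : Ctx (suc n) m} → IsHead C → IsHead (lamC C)

data Step (ρ : Rule) {n : ℕ} : Term n → Term n → Set where
  step : ∀ {m} (C : Ctx n m) {r r' : Term m} → Root ρ r r' → Step ρ (plug C r) (plug C r')

data NHStep (ρ : Rule) {n : ℕ} : Term n → Term n → Set where
  step : ∀ {m} (C : Ctx n m) → ¬ IsHead C → {r r' : Term m} → Root ρ r r' →
         NHStep ρ (plug C r) (plug C r')

StepRefl : Rule → ∀ {n} → Term n → Term n → Set
StepRefl ρ r q = r ≡ q ⊎ Step ρ r q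

module Submission where

-- Both parts are instances of one statement, proved uniformly in the rule ρ:
-- if t →¬hρ p and p ↦⊕ q, then t ↦⊕ r for some r with r →ρ= q.
--
-- The heart of the argument is a reflection property of non-head steps:
-- if C⟨r⟩ →¬hρ C⟨r'⟩ and C⟨r'⟩ is an ⊕-redex ⊕ a b, then C⟨r⟩ is already an
-- ⊕-redex ⊕ a₀ b₀ with a₀ →ρ= a and b₀ →ρ= b.  Indeed the hole cannot sit at
-- the root, at ⊕ a, or at ⊕ (those are head contexts), and cannot sit inside
-- the constant ⊕; so it lies inside a or inside b, and the other argument is
-- untouched.  Choosing the same branch of the ⊕-redex in C⟨r⟩ then closes
-- the square.

open import Defs
open import Data.Nat using (ℕ)
open import Data.Product using (Σ; _×_; _,_)
open import Data.Sum using (inj₁; inj₂)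
open import Data.Empty using (⊥-elim)
open import Relation.Nullary using (¬_)
open import Relation.Binary.PropositionalEquality using (_≡_; refl) renaming (subst to transport)

private
  variable
    n m : ℕ
    t a b q r r' : Term n

⊕redex : Term n → Term n → Term n
⊕redex a b = app (app ⊕ a) b

⊕-root-source : Root ⊕r t q → Σ (Term _) λ a → Σ (Term _) λ b → t ≡ ⊕redex a b
⊕-root-source (oplusL a b) = a , b , refl
⊕-root-source (oplusR a b) = a , b , refl

data ⊕Before (ρ : Rule) : Term n → Term n → Term n → Set where
  redex : ∀ {a₀ b₀ a b : Term n} → StepRefl ρ a₀ a → StepRefl ρ b₀ b →
          ⊕Before ρ (⊕redex a₀ b₀) a b

-- The hole, ⟨·⟩ u and ⟨·⟩ v u are head
-- contexts; contexts under λ or inside ⊕ cannot produce an ⊕-redex.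
⊕-reflect : ∀ ρ (C : Ctx n m) → ¬ IsHead C → Root ρ r r' →
            plug C r' ≡ ⊕redex a b → ⊕Before ρ (plug C r) a b
⊕-reflect ρ hole                           nh rt e    = ⊥-elim (nh (spine hole))
⊕-reflect ρ (appR u C)                     nh rt refl = redex (inj₁ refl) (inj₂ (step C rt))
⊕-reflect ρ (appL (appR v C) u)            nh rt refl = redex (inj₂ (step C rt)) (inj₁ refl)
⊕-reflect ρ (appL hole u)                  nh rt e    = ⊥-elim (nh (spine (appL u hole)))
⊕-reflect ρ (appL (appL hole v) u)         nh rt e    = ⊥-elim (nh (spine (appL u (appL v hole))))
⊕-reflect ρ (appL (appL (appR _ _) v) u)   nh rt ()
⊕-reflect ρ (appL (appL (appL _ _) v) u)   nh rt ()
⊕-reflect ρ (appL (appL (lamC _) v) u)     nh rt ()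
⊕-reflect ρ (appL (lamC _) u)              nh rt ()
⊕-reflect ρ (lamC C)                       nh rt ()

⊕-fire-before : ∀ {ρ} → ⊕Before ρ t a b → Root ⊕r (⊕redex a b) q →
                Σ (Term _) λ r → Root ⊕r t r × StepRefl ρ r q
⊕-fire-before (redex {a₀ = a₀} {b₀ = b₀} a₀→a _) (oplusL _ _) = a₀ , oplusL a₀ b₀ , a₀→a
⊕-fire-before (redex {a₀ = a₀} {b₀ = b₀} _ b₀→b) (oplusR _ _) = b₀ , oplusR a₀ b₀ , b₀→b

⊕-root-before-non-head : ∀ ρ (t p q : Term n) → NHStep ρ t p → Root ⊕r p q →
                         Σ (Term n) λ r → Root ⊕r t r × StepRefl ρ r q
⊕-root-before-non-head ρ _ _ q (step C nh rt) root⊕ with ⊕-root-source root⊕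
... | a , b , p≡⊕ab =
  ⊕-fire-before (⊕-reflect ρ C nh rt p≡⊕ab) (transport (λ p → Root ⊕r p q) p≡⊕ab root⊕)

lemma5p2 : (∀ {n} (t p q : Term n) → NHStep β t p → Root ⊕r p q →
             Σ (Term n) (λ r → Root ⊕r t r × StepRefl β r q))
           × (∀ {n} (t p q : Term n) → NHStep ⊕r t p → Root ⊕r p q →
             Σ (Term n) (λ r → Root ⊕r t r × StepRefl ⊕r r q))
lemma5p2 = ⊕-root-before-non-head β , ⊕-root-before-non-head ⊕r
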